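{- Let $\mathsf M$ be an oriented matroid with tope-pairs poset $\mathcal Q$. For $(R,T)\in\mathcal Q$ set $\rho(R,T):=(-T,R)$. Then $\rho$ is a poset isomorphism $\mathcal Q\to\mathcal Q^{op}$, and $\rho^4=\mathrm{id}$.
   Context: $\mathsf M$ is an oriented matroid on a finite ground set $E$. Its topes are the maximal covectors in $\{+,0,-\}^E$; $\mathcal T$ denotes the set of topes, and $-T$ is the componentwise negation of $T$. The separating set is $S(X,Y)=\{f\in E\mid X_f=-Y_f\neq0\}$. For $B\in\mathcal T$, write $T\le_B R$ iff $S(B,T)\subseteq S(B,R)$. The tope-pairs poset is $\mathcal Q=\mathcal T\times\mathcal T$ with $(T,R)\le(T',R')$ iff $T\le_{T'}R\le_{T'}R'$. $\mathcal Q^{op}$ is the same set with the reversed order. -}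

module Defs where

open import Data.Nat using (ℕ)
open import Data.Fin using (Fin)
open import Data.Vec using (Vec; lookup; map; zipWith; replicate)
open import Data.Product using (_×_; _,_; Σ; ∃-syntax; proj₁; proj₂)
open import Relation.Binary.PropositionalEquality using (_≡_; _≢_)
open import Relation.Nullary using (¬_)

data Sign : Set where
  plus zer minus : Sign

neg : Sign → Sign
neg plus  = minus
neg zer   = zer
neg minus = plus

SignVec : ℕ → Set
SignVec n = Vec Sign n

negV : ∀ {n} → SignVec n → SignVec n
negV = map neg

zeroV : ∀ {n} → SignVec n
zeroV = replicate _ zer

compS : Sign → Sign → Sign
compS zer y = y
compS x   _ = x

compV : ∀ {n} → SignVec n → SignVec n → SignVec n
compV = zipWith compS

Sep : ∀ {n} → SignVec n → SignVec n → Fin n → Set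
Sep X Y f = (lookup X f ≡ neg (lookup Y f)) × (lookup X f ≢ zer)

data _≤S_ : Sign → Sign → Set where
  0≤ : ∀ {y} → zer ≤S y
  refl≤ : ∀ {y} → y ≤S y

_≼_ : ∀ {n} → SignVec n → SignVec n → Set
X ≼ Y = ∀ f → lookup X f ≤S lookup Y f

record OrientedMatroid (n : ℕ) : Set₁ where
  field
    Cov      : SignVec n → Set
    cov-zero : Cov zeroV
    cov-neg  : ∀ {X} → Cov X → Cov (negV X)
    cov-comp : ∀ {X Y} → Cov X → Cov Y → Cov (compV X Y)
    cov-elim : ∀ {X Y} → Cov X → Cov Y → ∀ e → Sep X Y e →
               ∃[ Z ] (Cov Z × lookup Z e ≡ zer ×
                       (∀ f → ¬ Sep X Y f → lookup Z f ≡ lookup (compV X Y) f))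

  IsTope : SignVec n → Set
  IsTope T = Cov T × (∀ Y → Cov Y → T ≼ Y → Y ≡ T)

  _≤[_]_ : SignVec n → SignVec n → SignVec n → Set
  T ≤[ B ] R = ∀ f → Sep B T f → Sep B R f

  IsTopePair : SignVec n × SignVec n → Set
  IsTopePair (T , R) = IsTope T × IsTope R

  _≤Q_ : SignVec n × SignVec n → SignVec n × SignVec n → Set
  (T , R) ≤Q (T' , R') = (T ≤[ T' ] R) × (R ≤[ T' ] R')

ρ : ∀ {n} → SignVec n × SignVec n → SignVec n × SignVec n
ρ (R , T) = (negV T , R)

-- On the common support of the topes every coordinate is ±, so T ≤_B R says exactly that
-- T lies between B and R, i.e. no coordinate has T_f = -B_f = -R_f.  In this form the
-- relation Y ≤_X Z is symmetric in X, Z (given common support), and equivalent to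
-- X ≤_Y -Z and to -Y ≤_{-X} -Z.  Chaining these rules turns (T,R) ≤ (T',R'), i.e.
-- T ≤_{T'} R and R ≤_{T'} R', into -R' ≤_{-R} T' and T' ≤_{-R} T, which is
-- ρ(T',R') ≤ ρ(T,R); every step is reversible.
module Submission where

open import Defs
open import Data.Vec using (lookup)
open import Data.Vec.Properties using (lookup-map; lookup-zipWith; map-∘; map-cong; map-id)
open import Data.Empty using (⊥-elim)
open import Data.Product using (_×_; _,_; ∃-syntax)
open import Function using (_∘_)
open import Relation.Binary.PropositionalEquality
  using (_≡_; _≢_; refl; sym; trans; cong; cong₂; subst; subst₂; module ≡-Reasoning)

-- Sep X Y f is definitionally Opposed (lookup X f) (lookup Y f).
Opposed : Sign → Sign → Set
Opposed x y = (x ≡ neg y) × (x ≢ zer)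

neg-involutive : ∀ x → neg (neg x) ≡ x
neg-involutive plus  = refl
neg-involutive zer   = refl
neg-involutive minus = refl

negV-involutive : ∀ {n} (X : SignVec n) → negV (negV X) ≡ X
negV-involutive X = trans (sym (map-∘ neg neg X)) (trans (map-cong neg-involutive X) (map-id X))

lookup-negV : ∀ {n} (X : SignVec n) f → lookup (negV X) f ≡ neg (lookup X f)
lookup-negV X f = lookup-map f neg X

neg≢zer : ∀ {x} → x ≢ zer → neg x ≢ zer
neg≢zer x≢0 nx≡0 = x≢0 (trans (sym (neg-involutive _)) (cong neg nx≡0))

opposed-sym : ∀ {x y} → Opposed x y → Opposed y x
opposed-sym {y = y} (refl , ny≢0) = sym (neg-involutive y) , ny≢0 ∘ cong neg

opposed-neg : ∀ {x y} → Opposed x y → Opposed (neg x) (neg y)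
opposed-neg (refl , x≢0) = refl , neg≢zer x≢0

opposed-neg⁻¹ : ∀ {x y} → Opposed (neg x) (neg y) → Opposed x y
opposed-neg⁻¹ {x} {y} o = subst₂ Opposed (neg-involutive x) (neg-involutive y) (opposed-neg o)

opposed-opposed : ∀ {x y z} → Opposed x y → Opposed y z → Opposed x (neg z)
opposed-opposed (refl , x≢0) (refl , _) = refl , x≢0

opposed-opposed-neg : ∀ {x y z} → Opposed x y → Opposed y (neg z) → Opposed x z
opposed-opposed-neg {x} {z = z} o o′ = subst (Opposed x) (neg-involutive z) (opposed-opposed o o′)

opposed-swap : ∀ {x y z} → (x ≡ zer → z ≡ zer) →
               (Opposed x y → Opposed x z) → Opposed z y → Opposed z x
opposed-swap {zer}           z≡0 _ (refl , z≢0) = ⊥-elim (z≢0 (z≡0 refl))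
opposed-swap {_}     {zer}   _   _ (refl , z≢0) = ⊥-elim (z≢0 refl)
opposed-swap {plus}  {plus}  _   _ (refl , _)   = refl , λ ()
opposed-swap {minus} {minus} _   _ (refl , _)   = refl , λ ()
opposed-swap {plus}  {minus} _   h (refl , _)   with h (refl , λ ())
... | () , _
opposed-swap {minus} {plus}  _   h (refl , _)   with h (refl , λ ())
... | () , _

x≤S-compS : ∀ x y → x ≤S compS x y
x≤S-compS plus  _ = refl≤
x≤S-compS zer   _ = 0≤
x≤S-compS minus _ = refl≤

neg≤S⇒≤Sneg : ∀ {x y} → neg x ≤S y → x ≤S neg y
neg≤S⇒≤Sneg {zer}   _     = 0≤
neg≤S⇒≤Sneg {plus}  refl≤ = refl≤
neg≤S⇒≤Sneg {minus} refl≤ = refl≤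

ρ⁻¹ : ∀ {n} → SignVec n × SignVec n → SignVec n × SignVec n
ρ⁻¹ (A , B) = (B , negV A)

ρ-ρ⁻¹ : ∀ {n} (q : SignVec n × SignVec n) → ρ (ρ⁻¹ q) ≡ q
ρ-ρ⁻¹ (A , B) = cong (_, B) (negV-involutive A)

ρ⁻¹-ρ : ∀ {n} (p : SignVec n × SignVec n) → ρ⁻¹ (ρ p) ≡ p
ρ⁻¹-ρ (R , T) = cong (R ,_) (negV-involutive T)

ρ-injective : ∀ {n} {p q : SignVec n × SignVec n} → ρ p ≡ ρ q → p ≡ q
ρ-injective {p = p} {q} e = trans (sym (ρ⁻¹-ρ p)) (trans (cong ρ⁻¹ e) (ρ⁻¹-ρ q))

ρ⁴≡id : ∀ {n} (p : SignVec n × SignVec n) → ρ (ρ (ρ (ρ p))) ≡ p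
ρ⁴≡id (R , T) = cong₂ _,_ (negV-involutive R) (negV-involutive T)

module _ {n} (M : OrientedMatroid n) where
  open OrientedMatroid M

  tope-zero⇒cov-zero : ∀ {T Y} → IsTope T → Cov Y → ∀ f → lookup T f ≡ zer → lookup Y f ≡ zer
  tope-zero⇒cov-zero {T} {Y} (covT , maxT) covY f T_f≡0 = begin
    lookup Y f                      ≡⟨ cong (λ t → compS t (lookup Y f)) (sym T_f≡0) ⟩
    compS (lookup T f) (lookup Y f) ≡⟨ sym (lookup-zipWith compS f T Y) ⟩
    lookup (compV T Y) f            ≡⟨ cong (λ V → lookup V f) T∘Y≡T ⟩
    lookup T f                      ≡⟨ T_f≡0 ⟩
    zer                             ∎
    where
    open ≡-Reasoning
    T∘Y≡T : compV T Y ≡ T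
    T∘Y≡T = maxT _ (cov-comp covT covY) λ g →
      subst (lookup T g ≤S_) (sym (lookup-zipWith compS g T Y)) (x≤S-compS _ _)

  tope-negV : ∀ {T} → IsTope T → IsTope (negV T)
  tope-negV {T} (covT , maxT) = cov-neg covT , λ Y covY -T≼Y →
    trans (sym (negV-involutive Y)) (cong negV (maxT (negV Y) (cov-neg covY) λ f →
      subst (lookup T f ≤S_) (sym (lookup-negV Y f))
        (neg≤S⇒≤Sneg (subst (_≤S lookup Y f) (lookup-negV T f) (-T≼Y f)))))

  ≤[]-swap : ∀ X Y Z → (∀ f → lookup X f ≡ zer → lookup Z f ≡ zer) →
             Y ≤[ X ] Z → Y ≤[ Z ] X
  ≤[]-swap _ _ _ supp h f = opposed-swap (supp f) (h f)

  ≤[]-antipode : ∀ X Y Z → Y ≤[ X ] Z → X ≤[ Y ] negV Z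
  ≤[]-antipode _ Y Z h f o =
    subst (Opposed (lookup Y f)) (sym (lookup-negV Z f)) (opposed-opposed o (h f (opposed-sym o)))

  ≤[]-antipode⁻¹ : ∀ X Y Z → Y ≤[ X ] negV Z → X ≤[ Y ] Z
  ≤[]-antipode⁻¹ X _ Z h f o =
    opposed-opposed-neg o (subst (Opposed (lookup X f)) (lookup-negV Z f) (h f (opposed-sym o)))

  ≤[]-negV : ∀ X Y Z → Y ≤[ X ] Z → negV Y ≤[ negV X ] negV Z
  ≤[]-negV X Y Z h f o rewrite lookup-negV X f | lookup-negV Y f | lookup-negV Z f =
    opposed-neg (h f (opposed-neg⁻¹ o))

  ≤[]-negV⁻¹ : ∀ X Y Z → negV Y ≤[ negV X ] negV Z → Y ≤[ X ] Z
  ≤[]-negV⁻¹ X Y Z h f o with h f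
  ... | hf rewrite lookup-negV X f | lookup-negV Y f | lookup-negV Z f =
    opposed-neg⁻¹ (hf (opposed-neg o))

  tope-supports : ∀ {X Z} → IsTope X → IsTope Z → ∀ f → lookup X f ≡ zer → lookup Z f ≡ zer
  tope-supports tX (covZ , _) = tope-zero⇒cov-zero tX covZ

  ρ-antitone : ∀ {p q} → IsTopePair p → IsTopePair q → p ≤Q q → ρ q ≤Q ρ p
  ρ-antitone {T , R} {T′ , R′} (tT , tR) (tT′ , tR′) (T≤R , R≤R′) = -R′≤T′ , T′≤T
    where
    -R′≤T′ : negV R′ ≤[ negV R ] T′
    -R′≤T′ = ≤[]-antipode⁻¹ (negV R′) (negV R) T′
               (≤[]-negV R′ R T′ (≤[]-swap T′ R R′ (tope-supports tT′ tR′) R≤R′))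
    T′≤T : T′ ≤[ negV R ] T
    T′≤T = ≤[]-swap T T′ (negV R) (tope-supports tT (tope-negV tR)) (≤[]-antipode T′ T R T≤R)

  ρ-antitone⁻¹ : ∀ {p q} → IsTopePair p → IsTopePair q → ρ q ≤Q ρ p → p ≤Q q
  ρ-antitone⁻¹ {T , R} {T′ , R′} (tT , tR) (tT′ , tR′) (-R′≤T′ , T′≤T) = T≤R , R≤R′
    where
    T≤R : T ≤[ T′ ] R
    T≤R = ≤[]-antipode⁻¹ T T′ R (≤[]-swap (negV R) T′ T (tope-supports (tope-negV tR) tT) T′≤T)
    R≤R′ : R ≤[ T′ ] R′
    R≤R′ = ≤[]-swap R′ R T′ (tope-supports tR′ tT′)
             (≤[]-negV⁻¹ R′ R T′ (≤[]-antipode (negV R) (negV R′) T′ -R′≤T′))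

  ρ-preserves-IsTopePair : ∀ {p} → IsTopePair p → IsTopePair (ρ p)
  ρ-preserves-IsTopePair {R , T} (tR , tT) = tope-negV tT , tR

  ρ⁻¹-preserves-IsTopePair : ∀ {q} → IsTopePair q → IsTopePair (ρ⁻¹ q)
  ρ⁻¹-preserves-IsTopePair {A , B} (tA , tB) = tB , tope-negV tA

lemma3p13 : ∀ {n} (M : OrientedMatroid n) → let open OrientedMatroid M in
    ((p : SignVec n × SignVec n) → IsTopePair p → IsTopePair (ρ p))
    × ((p q : SignVec n × SignVec n) → IsTopePair p → IsTopePair q →
         ρ p ≡ ρ q → p ≡ q)
    × ((q : SignVec n × SignVec n) → IsTopePair q →
         ∃[ p ] (IsTopePair p × ρ p ≡ q))
    × ((p q : SignVec n × SignVec n) → IsTopePair p → IsTopePair q →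
         (p ≤Q q → ρ q ≤Q ρ p) × (ρ q ≤Q ρ p → p ≤Q q))
    × ((p : SignVec n × SignVec n) → IsTopePair p → ρ (ρ (ρ (ρ p))) ≡ p)
lemma3p13 M =
    (λ _ → ρ-preserves-IsTopePair M)
  , (λ _ _ _ _ → ρ-injective)
  , (λ q tq → ρ⁻¹ q , ρ⁻¹-preserves-IsTopePair M tq , ρ-ρ⁻¹ q)
  , (λ _ _ tp tq → ρ-antitone M tp tq , ρ-antitone⁻¹ M tp tq)
  , (λ p _ → ρ⁴≡id p)
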